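{- Let $r\ge 3$ and $1\le t\le r-2$ be integers, $n_1\ge\dots\ge n_r\ge2$. Let $\mathcal{F}\subseteq X_1\times\dots\times X_r$ be $t$-intersecting with $|\bigcap\mathcal{F}|<t$, and $\ell$-shift-resistant for some $\ell\in[r]$. Then $|\bigcap\mathcal{F}|=t-1$, and there exists $x\in X_\ell$ such that $N_{\mathcal{F}}(x,\ell)\ne\emptyset$, $N_{\mathcal{F}}(1,\ell)\ne\emptyset$, $\{S^{(\ell)}_x(A):A\in N_{\mathcal{F}}(x,\ell)\}\cap N_{\mathcal{F}}(x,\ell)=\emptyset$ (where $S^{(\ell)}_x$ is the shift map determined by $\mathcal{F}$), and $N_{\mathcal{F}}(y,\ell)=\emptyset$ for every $y\in X_\ell\setminus\{x,1\}$.
   Context: $X_\ell=\{1,\dots,n_\ell\}$. For $A\in X_1\times\dots\times X_r$, $A[\ell]$ is its $\ell$-th coordinate; $A\cap B=\{\ell: A[\ell]=B[\ell]\}$. $\mathcal{F}$ is $t$-intersecting if $|A\cap B|\ge t$ for all $A,B\in\mathcal{F}$; $\bigcap\mathcal{F}$ is the set of $\ell\in[r]$ such that all members of $\mathcal{F}$ have the same $\ell$-th coordinate. Shifts: for $\ell\in[r]$ and $1<j\le n_\ell$, given $\mathcal{F}$, for $A\in\mathcal{F}$ let $A'$ be $A$ with its $\ell$-th coordinate replaced by $1$; $S^{(\ell)}_j(A)=A'$ if $A[\ell]=j$ and $A'\notin\mathcal{F}$, else $S^{(\ell)}_j(A)=A$; $S^{(\ell)}_j(\mathcal{F})=\{S^{(\ell)}_j(A):A\in\mathcal{F}\}$.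 A $t$-intersecting family $\mathcal{F}$ with $|\bigcap\mathcal{F}|<t$ is $\ell$-shift-resistant if there exists $x\in X_\ell$, $x\neq 1$, such that $|\bigcap S^{(\ell)}_x(\mathcal{F})|=t$. For $x\in X_\ell$, $N_{\mathcal{F}}(x,\ell)=\{A\in\mathcal{F}:A[\ell]=x\}$. -}

module Defs where

open import Data.Nat using (ℕ; _≤_; _<_; _≟_)
open import Data.Fin using (Fin)
open import Data.Vec using (Vec; lookup; _[_]≔_)
import Data.Vec.Properties as VecP
open import Data.List using (List; []; length; filter; map; allFin)
open import Data.List.Relation.Unary.All using (All; all?)
open import Data.List.Membership.Propositional using (_∈_; _∉_)
import Data.List.Membership.DecPropositional as DecMem
open import Data.Product using (Σ; _×_)
open import Relation.Nullary using (Dec; yes; no; ¬_)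
open import Relation.Binary.PropositionalEquality using (_≡_)

-- A point of X_1 × … × X_r is a vector of naturals (coordinates are 1-based).
Point : ℕ → Set
Point r = Vec ℕ r

InProduct : {r : ℕ} → (Fin r → ℕ) → Point r → Set
InProduct {r} n A = (ℓ : Fin r) → (1 ≤ lookup A ℓ) × (lookup A ℓ ≤ n ℓ)

-- Families are (finite) lists of points, read as sets (membership ∈).
Family : ℕ → Set
Family r = List (Point r)

_∈?_ : {r : ℕ} → (A : Point r) → (F : Family r) → Dec (A ∈ F)
_∈?_ {r} = DecMem._∈?_ (VecP.≡-dec _≟_)

interSize : {r : ℕ} → Point r → Point r → ℕ
interSize {r} A B = length (filter (λ ℓ → lookup A ℓ ≟ lookup B ℓ) (allFin r))

TIntersecting : {r : ℕ} → ℕ → Family r → Set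
TIntersecting t F = ∀ A B → A ∈ F → B ∈ F → t ≤ interSize A B

CommonCoord : {r : ℕ} → Family r → Fin r → Set
CommonCoord F ℓ = All (λ A → All (λ B → lookup A ℓ ≡ lookup B ℓ) F) F

commonCoord? : {r : ℕ} → (F : Family r) → (ℓ : Fin r) → Dec (CommonCoord F ℓ)
commonCoord? F ℓ = all? (λ A → all? (λ B → lookup A ℓ ≟ lookup B ℓ) F) F

bigcap : {r : ℕ} → Family r → List (Fin r)
bigcap {r} F = filter (commonCoord? F) (allFin r)

bigcapSize : {r : ℕ} → Family r → ℕ
bigcapSize F = length (bigcap F)

replace1 : {r : ℕ} → Fin r → Point r → Point r
replace1 ℓ A = A [ ℓ ]≔ 1

shift : {r : ℕ} → Fin r → ℕ → Family r → Point r → Point r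
shift ℓ j F A with lookup A ℓ ≟ j | replace1 ℓ A ∈? F
... | yes _ | no _  = replace1 ℓ A
... | _     | _     = A

shiftFam : {r : ℕ} → Fin r → ℕ → Family r → Family r
shiftFam ℓ j F = map (shift ℓ j F) F

ShiftResistant : {r : ℕ} → (Fin r → ℕ) → ℕ → Fin r → Family r → Set
ShiftResistant n t ℓ F =
  TIntersecting t F × (bigcapSize F < t) ×
  Σ ℕ (λ x → (1 ≤ x) × (x ≤ n ℓ) × ¬ (x ≡ 1) × (bigcapSize (shiftFam ℓ x F) ≡ t))

Nbhd : {r : ℕ} → Family r → ℕ → Fin r → Family r
Nbhd F x ℓ = filter (λ A → lookup A ℓ ≟ x) F

{-# OPTIONS --safe #-}
-- Shifting in direction ℓ changes only ℓ-th coordinates, so ⋂ can gain at most the coordinate ℓ;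
-- shift-resistance therefore forces |⋂F| = t - 1 with ℓ ∈ ⋂ S_x(F) but ℓ ∉ ⋂F. The common ℓ-th
-- coordinate of S_x(F) must be 1, for otherwise no member of F moved and ℓ ∈ ⋂F. Hence every member
-- of F has ℓ-th coordinate 1 or x, both values occur because ℓ ∉ ⋂F, and the members at x move to 1.
module Submission where

open import Defs
open import Data.Nat using (ℕ; _≤_; _<_; _+_; _≟_; z≤n; s≤s)
import Data.Nat.Properties as ℕ
open import Data.Fin using (Fin) renaming (_≤_ to _≤ᶠ_)
import Data.Fin as Fin
open import Data.List using ([]; _∷_; length; filter; allFin)
open import Data.List.Relation.Unary.All using (All; []; _∷_)
import Data.List.Relation.Unary.All as All
open import Data.List.Relation.Unary.All.Properties using (all-filter)
open import Data.List.Relation.Unary.Any.Properties using (¬Any[])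
open import Data.List.Relation.Unary.Unique.Propositional using (Unique; []; _∷_)
import Data.List.Relation.Unary.Unique.Propositional.Properties as Unique
open import Data.List.Relation.Binary.Sublist.Propositional using (⊆-refl)
open import Data.List.Relation.Binary.Sublist.Propositional.Properties using (filter⁺)
open import Data.List.Relation.Binary.Sublist.Heterogeneous.Properties using (length-mono-≤)
open import Data.List.Membership.Propositional using (_∈_; _∉_)
open import Data.List.Membership.Propositional.Properties using (∈-map⁺; ∈-filter⁺; ∈-filter⁻)
open import Data.List.Properties using (filter-none)
open import Data.Vec using (lookup)
open import Data.Vec.Properties using (lookup∘update; lookup∘update′)
open import Data.Product using (Σ; _×_; _,_)
open import Data.Sum using (_⊎_; inj₁; inj₂; [_,_]′; swap)
open import Function using (id; _∘_)
open import Level using (Level)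
open import Relation.Binary.Definitions using (DecidableEquality)
open import Relation.Binary.PropositionalEquality using (_≡_; _≢_; refl; sym; trans; cong; subst; module ≡-Reasoning)
open import Relation.Nullary using (¬_; yes; no; ¬?; _×-dec_; contradiction)
open import Relation.Nullary.Decidable using (decidable-stable)
open import Relation.Unary using (Pred; Decidable; _∪_)
open import Relation.Unary.Properties using (_∪?_)

private variable
  a p q : Level
  X : Set a
  n r : ℕ
  ℓ k : Fin r
  c j y : ℕ
  A B : Point r
  F G : Family r

module _ {P : Pred X p} {Q : Pred X q} (P? : Decidable P) (Q? : Decidable Q) where

  length-filter-mono : (∀ {x} → P x → Q x) → ∀ xs → length (filter P? xs) ≤ length (filter Q? xs)
  length-filter-mono P⊆Q xs = length-mono-≤ (filter⁺ P? Q? (λ { refl → P⊆Q }) (⊆-refl {x = xs}))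

  length-filter-∪ : ∀ xs → length (filter (P? ∪? Q?) xs) ≤ length (filter P? xs) + length (filter Q? xs)
  length-filter-∪ [] = z≤n
  length-filter-∪ (x ∷ xs) with P? x | Q? x
  ... | yes _ | yes _ = s≤s (ℕ.≤-trans (length-filter-∪ xs) (ℕ.+-monoʳ-≤ _ (ℕ.n≤1+n _)))
  ... | yes _ | no _ = s≤s (length-filter-∪ xs)
  ... | no _ | yes _ = ℕ.≤-trans (s≤s (length-filter-∪ xs)) (ℕ.≤-reflexive (sym (ℕ.+-suc _ _)))
  ... | no _ | no _ = length-filter-∪ xs

module _ (_≟_ : DecidableEquality X) where

  length-filter-≡-≤1 : ∀ {xs} y → Unique xs → length (filter (_≟ y) xs) ≤ 1
  length-filter-≡-≤1 {xs = xs} y uniq = length≤1 (Unique.filter⁺ (_≟ y) uniq) (all-filter (_≟ y) xs)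
    where
    length≤1 : ∀ {ys} → Unique ys → All (_≡ y) ys → length ys ≤ 1
    length≤1 [] _ = z≤n
    length≤1 (_ ∷ []) _ = s≤s z≤n
    length≤1 ((y≢y ∷ _) ∷ _) (refl ∷ refl ∷ _) = contradiction refl y≢y

count : {P : Pred (Fin n) p} → Decidable P → ℕ
count {n = n} P? = length (filter P? (allFin n))

module _ {P : Pred (Fin n) p} {Q : Pred (Fin n) q} (P? : Decidable P) (Q? : Decidable Q)
         (ℓ : Fin n) (Q⊆P : ∀ {k} → k ≢ ℓ → Q k → P k) where

  count-≤+1 : count Q? ≤ count P? + 1
  count-≤+1 = begin
    count Q?                       ≤⟨ length-filter-mono Q? (P? ∪? (Fin._≟ ℓ)) Q⊆P∪ℓ (allFin n) ⟩
    count (P? ∪? (Fin._≟ ℓ))       ≤⟨ length-filter-∪ P? (Fin._≟ ℓ) (allFin n) ⟩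
    count P? + count (Fin._≟ ℓ)    ≤⟨ ℕ.+-monoʳ-≤ (count P?) (length-filter-≡-≤1 Fin._≟_ ℓ (Unique.allFin⁺ n)) ⟩
    count P? + 1                   ∎
    where
    open ℕ.≤-Reasoning
    Q⊆P∪ℓ : ∀ {k} → Q k → (P ∪ (_≡ ℓ)) k
    Q⊆P∪ℓ {k} Qk with k Fin.≟ ℓ
    ... | yes k≡ℓ = inj₂ k≡ℓ
    ... | no k≢ℓ = inj₁ (Q⊆P k≢ℓ Qk)

  count-jump : count P? < count Q? → count P? + 1 ≡ count Q? × Q ℓ × ¬ P ℓ
  count-jump P<Q = ℕ.≤-antisym (subst (_≤ count Q?) (ℕ.+-comm 1 _) P<Q) count-≤+1 , jumps-at-ℓ
    where
    Q⊆P-unless-jump : ¬ (Q ℓ × ¬ P ℓ) → ∀ {k} → Q k → P k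
    Q⊆P-unless-jump no-jump {k} Qk with k Fin.≟ ℓ
    ... | no k≢ℓ = Q⊆P k≢ℓ Qk
    ... | yes refl = decidable-stable (P? ℓ) (λ ¬Pℓ → no-jump (Qk , ¬Pℓ))
    jumps-at-ℓ : Q ℓ × ¬ P ℓ
    jumps-at-ℓ with Q? ℓ ×-dec ¬? (P? ℓ)
    ... | yes jump = jump
    ... | no no-jump = contradiction (length-filter-mono Q? P? (Q⊆P-unless-jump no-jump) (allFin n)) (ℕ.<⇒≱ P<Q)

shift-fixes⊎lookup≡1 : ∀ ℓ j F (A : Point r) → shift ℓ j F A ≡ A ⊎ lookup (shift ℓ j F A) ℓ ≡ 1
shift-fixes⊎lookup≡1 ℓ j F A with lookup A ℓ ≟ j | replace1 ℓ A ∈? F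
... | yes _ | no _  = inj₂ (lookup∘update ℓ A 1)
... | yes _ | yes _ = inj₁ refl
... | no _  | _     = inj₁ refl

shift-fixes : ∀ ℓ j F (A : Point r) → lookup A ℓ ≢ j → shift ℓ j F A ≡ A
shift-fixes ℓ j F A Aℓ≢j with lookup A ℓ ≟ j
... | yes Aℓ≡j = contradiction Aℓ≡j Aℓ≢j
... | no _     = refl

lookup-shift-≢ : ∀ ℓ j F (A : Point r) → k ≢ ℓ → lookup (shift ℓ j F A) k ≡ lookup A k
lookup-shift-≢ ℓ j F A k≢ℓ with lookup A ℓ ≟ j | replace1 ℓ A ∈? F
... | yes _ | no _  = lookup∘update′ k≢ℓ A 1
... | yes _ | yes _ = refl
... | no _  | _     = refl

CommonCoord⇒≡ : CommonCoord G k → A ∈ G → B ∈ G → lookup A k ≡ lookup B k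
CommonCoord⇒≡ common A∈G B∈G = All.lookup (All.lookup common A∈G) B∈G

constant⇒CommonCoord : (∀ {A} → A ∈ G → lookup A k ≡ c) → CommonCoord G k
constant⇒CommonCoord ≡c = All.tabulate λ A∈G → All.tabulate λ B∈G → trans (≡c A∈G) (sym (≡c B∈G))

CommonCoord-unshift : ∀ ℓ j F → k ≢ ℓ → CommonCoord (shiftFam ℓ j F) k → CommonCoord F k
CommonCoord-unshift {k = k} ℓ j F k≢ℓ common = All.tabulate λ {A} A∈F → All.tabulate λ {B} B∈F → begin
  lookup A k                  ≡⟨ sym (lookup-shift-≢ ℓ j F A k≢ℓ) ⟩
  lookup (shift ℓ j F A) k    ≡⟨ CommonCoord⇒≡ common (∈-map⁺ (shift ℓ j F) A∈F) (∈-map⁺ (shift ℓ j F) B∈F) ⟩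
  lookup (shift ℓ j F B) k    ≡⟨ lookup-shift-≢ ℓ j F B k≢ℓ ⟩
  lookup B k                  ∎
  where open ≡-Reasoning

bigcap-shift-jump : ∀ ℓ j (F : Family r) → bigcapSize F < bigcapSize (shiftFam ℓ j F) →
  bigcapSize F + 1 ≡ bigcapSize (shiftFam ℓ j F) × CommonCoord (shiftFam ℓ j F) ℓ × ¬ CommonCoord F ℓ
bigcap-shift-jump ℓ j F =
  count-jump (commonCoord? F) (commonCoord? (shiftFam ℓ j F)) ℓ (CommonCoord-unshift ℓ j F)

Nbhd≡[] : (∀ {A} → A ∈ F → lookup A ℓ ≢ y) → Nbhd F y ℓ ≡ []
Nbhd≡[] {ℓ = ℓ} {y = y} ≢y = filter-none (λ A → lookup A ℓ ≟ y) (All.tabulate ≢y)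

Nbhd≡[]⇒ : Nbhd F y ℓ ≡ [] → A ∈ F → lookup A ℓ ≢ y
Nbhd≡[]⇒ {A = A} empty A∈F Aℓ≡y = ¬Any[] (subst (A ∈_) empty (∈-filter⁺ _ A∈F Aℓ≡y))

Nbhd≢[] : ¬ CommonCoord F ℓ → (∀ {A} → A ∈ F → lookup A ℓ ≡ y ⊎ lookup A ℓ ≡ c) → Nbhd F y ℓ ≢ []
Nbhd≢[] ℓ∉⋂F two-valued empty =
  ℓ∉⋂F (constant⇒CommonCoord λ A∈F → [ (λ ≡y → contradiction ≡y (Nbhd≡[]⇒ empty A∈F)) , id ]′ (two-valued A∈F))

module ShiftResistance (ℓ : Fin r) (x : ℕ) (F : Family r)
  (ℓ∈⋂SF : CommonCoord (shiftFam ℓ x F) ℓ) (ℓ∉⋂F : ¬ CommonCoord F ℓ) where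

  shifts-agree : A ∈ F → B ∈ F → lookup (shift ℓ x F A) ℓ ≡ lookup (shift ℓ x F B) ℓ
  shifts-agree A∈F B∈F = CommonCoord⇒≡ ℓ∈⋂SF (∈-map⁺ (shift ℓ x F) A∈F) (∈-map⁺ (shift ℓ x F) B∈F)

  -- A common ℓ-th coordinate of S_x(F) other than 1 would mean that no member moved, i.e. ℓ ∈ ⋂F.
  lookup-shift≡1 : A ∈ F → lookup (shift ℓ x F A) ℓ ≡ 1
  lookup-shift≡1 {A = A} A∈F with lookup (shift ℓ x F A) ℓ ≟ 1
  ... | yes ≡1 = ≡1
  ... | no ≢1 = contradiction (constant⇒CommonCoord unmoved) ℓ∉⋂F
    where
    unmoved : B ∈ F → lookup B ℓ ≡ lookup (shift ℓ x F A) ℓ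
    unmoved {B} B∈F with shift-fixes⊎lookup≡1 ℓ x F B
    ... | inj₁ fixed = trans (cong (λ C → lookup C ℓ) (sym fixed)) (shifts-agree B∈F A∈F)
    ... | inj₂ moved = contradiction (trans (sym (shifts-agree B∈F A∈F)) moved) ≢1

  lookup≡1⊎≡x : A ∈ F → lookup A ℓ ≡ 1 ⊎ lookup A ℓ ≡ x
  lookup≡1⊎≡x {A = A} A∈F with lookup A ℓ ≟ x
  ... | yes ≡x = inj₂ ≡x
  ... | no ≢x = inj₁ (trans (cong (λ C → lookup C ℓ) (sym (shift-fixes ℓ x F A ≢x))) (lookup-shift≡1 A∈F))

  Nbhd-1≢[] : Nbhd F 1 ℓ ≢ []
  Nbhd-1≢[] = Nbhd≢[] ℓ∉⋂F lookup≡1⊎≡x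

  Nbhd-x≢[] : Nbhd F x ℓ ≢ []
  Nbhd-x≢[] = Nbhd≢[] ℓ∉⋂F (swap ∘ lookup≡1⊎≡x)

  Nbhd-other≡[] : y ≢ x → y ≢ 1 → Nbhd F y ℓ ≡ []
  Nbhd-other≡[] y≢x y≢1 = Nbhd≡[] λ A∈F Aℓ≡y →
    [ y≢1 ∘ trans (sym Aℓ≡y) , y≢x ∘ trans (sym Aℓ≡y) ]′ (lookup≡1⊎≡x A∈F)

  shift∉Nbhd : x ≢ 1 → ∀ A → A ∈ Nbhd F x ℓ → shift ℓ x F A ∉ Nbhd F x ℓ
  shift∉Nbhd x≢1 A A∈N SA∈N
    with A∈F , _ ← ∈-filter⁻ _ {xs = F} A∈N | _ , SAℓ≡x ← ∈-filter⁻ _ {xs = F} SA∈N =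
    x≢1 (trans (sym SAℓ≡x) (lookup-shift≡1 A∈F))

lemma2p2 : (r t : ℕ) (n : Fin r → ℕ) →
    3 ≤ r → 1 ≤ t → t + 2 ≤ r →
    (∀ i j → i ≤ᶠ j → n j ≤ n i) → (∀ i → 2 ≤ n i) →
    (F : Family r) → All (InProduct n) F →
    TIntersecting t F → bigcapSize F < t →
    (ℓ : Fin r) → ShiftResistant n t ℓ F →
    (bigcapSize F + 1 ≡ t) ×
    Σ ℕ (λ x → (1 ≤ x) × (x ≤ n ℓ) ×
      ¬ (Nbhd F x ℓ ≡ []) × ¬ (Nbhd F 1 ℓ ≡ []) ×
      (∀ A → A ∈ Nbhd F x ℓ → shift ℓ x F A ∉ Nbhd F x ℓ) ×
      (∀ y → 1 ≤ y → y ≤ n ℓ → ¬ (y ≡ x) → ¬ (y ≡ 1) → Nbhd F y ℓ ≡ []))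
lemma2p2 r t n _ _ _ _ _ F _ _ ⋂F<t ℓ (_ , _ , x , 1≤x , x≤nℓ , x≢1 , ⋂SF≡t)
  with ⋂F+1≡⋂SF , ℓ∈⋂SF , ℓ∉⋂F ← bigcap-shift-jump ℓ x F (subst (bigcapSize F <_) (sym ⋂SF≡t) ⋂F<t) =
  trans ⋂F+1≡⋂SF ⋂SF≡t ,
  x , 1≤x , x≤nℓ , Nbhd-x≢[] , Nbhd-1≢[] , shift∉Nbhd x≢1 , λ _ _ _ → Nbhd-other≡[]
  where open ShiftResistance ℓ x F ℓ∈⋂SF ℓ∉⋂F
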